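{- Let $n\ge1$, $k\ge2$, $x\in[k]^{n-1}$ with $x\ne0^{n-1}$, and $\sigma\in[k]$. If $tail(x\sigma)=n-1$, then $val(0x)-val(x\sigma)\ge-(k-1)\cdot k^{head(x\sigma)}$.
   Context: $[k]=\{0,\dots,k-1\}$; words written by concatenation. For $s=\sigma_0\cdots\sigma_{n-1}\in[k]^n$ and $0\le m<n$: $val(s,m)=\sum_{i=1}^n \sigma_{(m-i)\bmod n}k^{i-1}$; $val(s)=\max_{0\le m<n} val(s,m)$; $head(s)=\min\{m\in\{0,\dots,n-1\} : val(s,m)=val(s)\}$; for $s\ne0^n$, $tail(s)=\big(\max\{i\in\mathbb{Z} : i<head(s),\ \sigma_{i\bmod n}\ne0\}\big)\bmod n$. -}

module Defs where

open import Data.Nat using (ℕ; zero; suc; _+_; _*_; _∸_; _^_; _⊔_; NonZero; _≟_)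
open import Data.Nat.DivMod using (_%_; m%n<n)
open import Data.Nat.Properties using ()
open import Data.Fin using (fromℕ<)
open import Data.Vec using (Vec; lookup)
open import Data.List using (List; []; _∷_; map; foldr; upTo)
open import Data.Nat.ListAction using (sum)
open import Data.Bool using (Bool; true; false; not)
open import Relation.Nullary.Decidable using (⌊_⌋)

-- A word s = σ_0 ⋯ σ_{n-1} ∈ [k]^n is represented by a vector of naturals
-- (the alphabet bound σ_i < k is imposed as a hypothesis where needed).

digit : ∀ {n} .{{_ : NonZero n}} → Vec ℕ n → ℕ → ℕ
digit {n} s j = lookup s (fromℕ< (m%n<n j n))

-- val(s,m) = Σ_{i=1}^{n} σ_{(m-i) mod n} k^{i-1}   (for m < n, (m-i) mod n = (m+n-i) mod n)
val : ∀ {n} .{{_ : NonZero n}} → ℕ → Vec ℕ n → ℕ → ℕ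
val {n} k s m = sum (map (λ j → digit s (m + n ∸ suc j) * k ^ j) (upTo n))

valMax : ∀ {n} .{{_ : NonZero n}} → ℕ → Vec ℕ n → ℕ
valMax {n} k s = foldr _⊔_ 0 (map (val k s) (upTo n))

firstWith : (ℕ → Bool) → List ℕ → ℕ
firstWith p [] = 0
firstWith p (x ∷ xs) with p x
... | true  = x
... | false = firstWith p xs

head : ∀ {n} .{{_ : NonZero n}} → ℕ → Vec ℕ n → ℕ
head {n} k s = firstWith (λ m → ⌊ val k s m ≟ valMax k s ⌋) (upTo n)

-- tail(s) = (max { i ∈ ℤ : i < head(s), σ_{i mod n} ≠ 0 }) mod n.
-- Writing i = head(s) - d with d ≥ 1, the maximal such i corresponds to the least
-- d ≥ 1 with σ_{(head(s)-d) mod n} ≠ 0; since σ is n-periodic in i, for s ≠ 0^n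
-- such d exists in {1,…,n}.  tail(s) = (head(s) - d) mod n = (head(s) + n - d) mod n.
tail : ∀ {n} .{{_ : NonZero n}} → ℕ → Vec ℕ n → ℕ
tail {n} k s = (h + n ∸ d) % n
  where
  h = head k s
  d = firstWith (λ e → not ⌊ digit s (h + n ∸ e) ≟ 0 ⌋) (map suc (upTo n))

-- Up to the last letter, xσ is 0x shifted cyclically by one place: reading xσ
-- from position m meets the letters of 0x read from position m + 1, except that the
-- σ of weight k^m is met as the 0 of 0x.  Hence val(xσ, m) = val(0x, m + 1) + σ k^m,
-- and at m = head(xσ) this gives val(xσ) ≤ val(0x) + (k - 1) k^head(xσ).
module Submission where

open import Defs
open import Data.Nat using (ℕ; suc; _≤_; _<_; _∸_; _*_; _^_)
open import Data.Integer using (ℤ; +_; -_) renaming (_-_ to _-ℤ_; _≥_ to _≥ℤ_)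
open import Data.Vec using (Vec; _∷_; _∷ʳ_; replicate)
open import Data.Vec.Relation.Unary.All using (All)
open import Relation.Binary.PropositionalEquality using (_≡_; _≢_)

open import Data.Integer using (_⊖_) renaming (_≤_ to _≤ℤ_)
open import Data.Nat using (zero; _+_; _⊔_; _≟_; s≤s; s≤s⁻¹; z<s; NonZero)
open import Data.Nat.Properties
open import Data.Nat.DivMod using (_%_; _/_; m%n<n; m≡m%n+[m/n]*n; [m+kn]%n≡m%n; [m+n]%n≡m%n; m<n⇒m%n≡m; n%n≡0)
open import Data.Nat.ListAction using (sum)
open import Data.Fin using (fromℕ<)
open import Data.Fin.Properties using (fromℕ<-cong)
open import Data.Vec using (lookup; [])
open import Data.List using ([]; _∷_; map; foldr; upTo; applyUpTo)
open import Data.List.Properties using (map-upTo)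
open import Data.List.Membership.Propositional using (_∈_)
open import Data.List.Membership.Propositional.Properties using (∈-upTo⁺; ∈-upTo⁻)
open import Data.List.Relation.Unary.Any using (here; there)
open import Data.Bool using (Bool; true; false)
open import Data.Bool.Properties using (T-≡)
open import Data.Product using (∃; _×_; _,_)
open import Data.Sum using (inj₁; inj₂)
open import Data.Empty using (⊥-elim)
open import Function.Bundles using (Equivalence)
open import Relation.Nullary.Decidable using (⌊_⌋; toWitness; dec-true; isYes≗does)
open import Relation.Binary.PropositionalEquality using (refl; sym; trans; cong; cong₂; subst; module ≡-Reasoning)
open import Function using (_∘_)
import Data.Integer.Properties as ℤ
open import Algebra.Properties.CommutativeSemigroup +-commutativeSemigroup using (xy∙z≈xz∙y)

suc-% : ∀ i n .{{_ : NonZero n}} → suc (i % n) < n → suc i % n ≡ suc (i % n)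
suc-% i n lt = begin
  suc i % n                       ≡⟨ cong (λ z → suc z % n) (m≡m%n+[m/n]*n i n) ⟩
  (suc (i % n) + (i / n) * n) % n ≡⟨ [m+kn]%n≡m%n (suc (i % n)) (i / n) n ⟩
  suc (i % n) % n                 ≡⟨ m<n⇒m%n≡m lt ⟩
  suc (i % n)                     ∎
  where open ≡-Reasoning

-- With N = suc n: if i + j + 1 = m + N where m, j < N, then i < 2N - 1, so
-- i ≡ N - 1 (mod N) forces i = N - 1, i.e. j = m.
%≡pred⇒≡ : ∀ {n m j i} → m ≤ n → i + suc j ≡ m + suc n → i % suc n ≡ n → j ≡ m
%≡pred⇒≡ {n} {m} {j} {i} m≤n sum≡ i%≡n =
  quotient-cases (i / suc n) (trans (m≡m%n+[m/n]*n i (suc n)) (cong (_+ (i / suc n) * suc n) i%≡n))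
  where
  open ≤-Reasoning
  quotient-cases : ∀ q → i ≡ n + q * suc n → j ≡ m
  quotient-cases zero i≡ = +-cancelˡ-≡ (suc n) j m (begin-equality
    suc n + j  ≡⟨ +-suc n j ⟨
    n + suc j  ≡⟨ cong (_+ suc j) (trans (sym (+-identityʳ n)) (sym i≡)) ⟩
    i + suc j  ≡⟨ sum≡ ⟩
    m + suc n  ≡⟨ +-comm m (suc n) ⟩
    suc n + m  ∎)
  quotient-cases (suc q) i≡ = ⊥-elim (<-irrefl (sym sum≡) (begin-strict
    m + suc n          ≤⟨ +-monoˡ-≤ (suc n) m≤n ⟩
    n + suc n          ≤⟨ +-monoʳ-≤ n (m≤m+n (suc n) (q * suc n)) ⟩
    n + suc q * suc n  ≡⟨ i≡ ⟨
    i                  <⟨ m<m+n i z<s ⟩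
    i + suc j          ∎))

lookup-∷ʳ-fromℕ< : ∀ {a} {A : Set a} {n} (x : Vec A n) (σ : A) {r} .(r<n : r < n) .(r<1+n : r < suc n) →
                   lookup (x ∷ʳ σ) (fromℕ< r<1+n) ≡ lookup x (fromℕ< r<n)
lookup-∷ʳ-fromℕ< (a ∷ x) σ {zero}  r<n r<1+n = refl
lookup-∷ʳ-fromℕ< (a ∷ x) σ {suc r} r<n r<1+n = lookup-∷ʳ-fromℕ< x σ (s≤s⁻¹ r<n) (s≤s⁻¹ r<1+n)

lookup-∷ʳ-last : ∀ {a} {A : Set a} {n} (x : Vec A n) (σ : A) .(n<1+n : n < suc n) →
                 lookup (x ∷ʳ σ) (fromℕ< n<1+n) ≡ σ
lookup-∷ʳ-last []      σ n<1+n = refl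
lookup-∷ʳ-last (a ∷ x) σ n<1+n = lookup-∷ʳ-last x σ (s≤s⁻¹ n<1+n)

digit-≡-lookup : ∀ {n} .{{_ : NonZero n}} (s : Vec ℕ n) i {r} → i % n ≡ r → .(r<n : r < n) →
                 digit s i ≡ lookup s (fromℕ< r<n)
digit-≡-lookup {n} s i i%n≡r r<n = cong (lookup s) (fromℕ<-cong _ _ i%n≡r (m%n<n i n) r<n)

digit-+n : ∀ {n} .{{_ : NonZero n}} (s : Vec ℕ n) i → digit s (i + n) ≡ digit s i
digit-+n {n} s i = digit-≡-lookup s (i + n) ([m+n]%n≡m%n i n) (m%n<n i n)

digit-∷ʳ-last : ∀ {n} (x : Vec ℕ n) σ → digit (x ∷ʳ σ) n ≡ σ
digit-∷ʳ-last {n} x σ =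
  trans (digit-≡-lookup (x ∷ʳ σ) n (m<n⇒m%n≡m (n<1+n n)) (n<1+n n)) (lookup-∷ʳ-last x σ (n<1+n n))

digit-∷-period : ∀ {n} (x : Vec ℕ n) → digit (0 ∷ x) (suc n) ≡ 0
digit-∷-period {n} x = digit-≡-lookup (0 ∷ x) (suc n) (n%n≡0 (suc n)) z<s

digit-∷-suc : ∀ {n} (x : Vec ℕ n) σ i → i % suc n ≢ n → digit (0 ∷ x) (suc i) ≡ digit (x ∷ʳ σ) i
digit-∷-suc {n} x σ i i%≢n = begin
  digit (0 ∷ x) (suc i)                  ≡⟨ digit-≡-lookup (0 ∷ x) (suc i) (suc-% i (suc n) (s≤s r<n)) (s≤s r<n) ⟩
  lookup x (fromℕ< r<n)                  ≡⟨ lookup-∷ʳ-fromℕ< x σ r<n (m%n<n i (suc n)) ⟨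
  digit (x ∷ʳ σ) i                       ∎
  where
  open ≡-Reasoning
  r<n : i % suc n < n
  r<n = ≤∧≢⇒< (s≤s⁻¹ (m%n<n i (suc n))) i%≢n

sum-applyUpTo-cong : ∀ (f g : ℕ → ℕ) n → (∀ {j} → j < n → f j ≡ g j) →
                     sum (applyUpTo f n) ≡ sum (applyUpTo g n)
sum-applyUpTo-cong f g zero    f≗g = refl
sum-applyUpTo-cong f g (suc n) f≗g =
  cong₂ _+_ (f≗g z<s) (sum-applyUpTo-cong (f ∘ suc) (g ∘ suc) n (f≗g ∘ s≤s))

sum-applyUpTo-update : ∀ (f g : ℕ → ℕ) {c m} n → m < n →
                       (∀ {j} → j < n → j ≢ m → f j ≡ g j) → f m ≡ g m + c →
                       sum (applyUpTo f n) ≡ sum (applyUpTo g n) + c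
sum-applyUpTo-update f g {c} {zero} (suc n) m<n f≗g fm≡ = begin
  f 0 + sum (applyUpTo (f ∘ suc) n)     ≡⟨ cong₂ _+_ fm≡ (sum-applyUpTo-cong (f ∘ suc) (g ∘ suc) n tail-agree) ⟩
  g 0 + c + sum (applyUpTo (g ∘ suc) n) ≡⟨ xy∙z≈xz∙y (g 0) c _ ⟩
  g 0 + sum (applyUpTo (g ∘ suc) n) + c ∎
  where
  open ≡-Reasoning
  tail-agree : ∀ {j} → j < n → f (suc j) ≡ g (suc j)
  tail-agree j<n = f≗g (s≤s j<n) λ ()
sum-applyUpTo-update f g {c} {suc m} (suc n) m<n f≗g fm≡ = begin
  f 0 + sum (applyUpTo (f ∘ suc) n)       ≡⟨ cong₂ _+_ (f≗g z<s λ ()) tail-update ⟩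
  g 0 + (sum (applyUpTo (g ∘ suc) n) + c) ≡⟨ +-assoc (g 0) _ c ⟨
  g 0 + sum (applyUpTo (g ∘ suc) n) + c   ∎
  where
  open ≡-Reasoning
  tail-update : sum (applyUpTo (f ∘ suc) n) ≡ sum (applyUpTo (g ∘ suc) n) + c
  tail-update = sum-applyUpTo-update (f ∘ suc) (g ∘ suc) n (s≤s⁻¹ m<n)
                  (λ j<n j≢m → f≗g (s≤s j<n) (j≢m ∘ suc-injective)) fm≡

val-∷ʳ-rotate : ∀ k {n} (x : Vec ℕ n) σ {m} → m < suc n →
                val k (x ∷ʳ σ) m ≡ val k (0 ∷ x) (suc m) + σ * k ^ m
val-∷ʳ-rotate k {n} x σ {m} m<N = begin
  val k s m                             ≡⟨ cong sum (map-upTo F N) ⟩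
  sum (applyUpTo F N)                   ≡⟨ sum-applyUpTo-update F G N m<N F≗G Fm≡ ⟩
  sum (applyUpTo G N) + σ * k ^ m       ≡⟨ cong (λ z → sum z + σ * k ^ m) (map-upTo G N) ⟨
  val k t (suc m) + σ * k ^ m           ∎
  where
  open ≡-Reasoning
  N = suc n
  s = x ∷ʳ σ
  t = 0 ∷ x
  F G : ℕ → ℕ
  F j = digit s (m + N ∸ suc j) * k ^ j
  G j = digit t (suc m + N ∸ suc j) * k ^ j

  F≗G : ∀ {j} → j < N → j ≢ m → F j ≡ G j
  F≗G {j} j<N j≢m = cong (_* k ^ j) (begin
    digit s i                   ≡⟨ digit-∷-suc x σ i i%≢n ⟨
    digit t (suc i)             ≡⟨ cong (digit t) (+-∸-assoc 1 1+j≤m+N) ⟨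
    digit t (suc m + N ∸ suc j) ∎)
    where
    i = m + N ∸ suc j
    1+j≤m+N : suc j ≤ m + N
    1+j≤m+N = ≤-trans j<N (m≤n+m N m)
    i%≢n : i % N ≢ n
    i%≢n = j≢m ∘ %≡pred⇒≡ (s≤s⁻¹ m<N) (m∸n+n≡m 1+j≤m+N)

  Fm≡ : F m ≡ G m + σ * k ^ m
  Fm≡ = begin
    digit s (m + N ∸ suc m) * k ^ m    ≡⟨ cong (λ i → digit s (i ∸ suc m) * k ^ m) (+-suc m n) ⟩
    digit s (m + n ∸ m) * k ^ m        ≡⟨ cong (λ i → digit s i * k ^ m) (m+n∸m≡n m n) ⟩
    digit s n * k ^ m                  ≡⟨ cong (_* k ^ m) (digit-∷ʳ-last x σ) ⟩
    σ * k ^ m                          ≡⟨ cong (λ d → d * k ^ m + σ * k ^ m) (digit-∷-period x) ⟨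
    digit t N * k ^ m + σ * k ^ m      ≡⟨ cong (λ i → digit t i * k ^ m + σ * k ^ m) (m+n∸m≡n m N) ⟨
    G m + σ * k ^ m                    ∎

≤-foldr-⊔ : ∀ (f : ℕ → ℕ) {xs y} → y ∈ xs → f y ≤ foldr _⊔_ 0 (map f xs)
≤-foldr-⊔ f {x ∷ xs} (here refl) = m≤m⊔n (f x) _
≤-foldr-⊔ f {x ∷ xs} (there y∈xs) = ≤-trans (≤-foldr-⊔ f y∈xs) (m≤n⊔m (f x) _)

foldr-⊔-attained : ∀ (f : ℕ → ℕ) x xs → ∃ λ y → y ∈ x ∷ xs × foldr _⊔_ 0 (map f (x ∷ xs)) ≡ f y
foldr-⊔-attained f x [] = x , here refl , ⊔-identityʳ (f x)
foldr-⊔-attained f x (x′ ∷ xs) with foldr-⊔-attained f x′ xs | ⊔-sel (f x) (foldr _⊔_ 0 (map f (x′ ∷ xs)))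
... | _ , _      , _  | inj₁ max≡fx = x , here refl , max≡fx
... | y , y∈x′∷xs , eq | inj₂ max≡rest = y , there y∈x′∷xs , trans max≡rest eq

firstWith-sound : ∀ (p : ℕ → Bool) {xs y} → y ∈ xs → p y ≡ true →
                  p (firstWith p xs) ≡ true × firstWith p xs ∈ xs
firstWith-sound p {x ∷ xs} y∈ py with p x in px
... | true = px , here refl
firstWith-sound p {x ∷ xs} (here refl) py | false with () ← trans (sym px) py
firstWith-sound p {x ∷ xs} (there y∈xs) py | false with firstWith-sound p y∈xs py
... | found , found∈xs = found , there found∈xs

head-spec : ∀ k {n} (s : Vec ℕ (suc n)) → head k s < suc n × val k s (head k s) ≡ valMax k s
head-spec k {n} s =
  let m , m∈ , max≡  = foldr-⊔-attained (val k s) 0 (applyUpTo suc n)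
      found , head∈  = firstWith-sound attains-max m∈ (attains-max-≡true m (sym max≡))
  in  ∈-upTo⁻ head∈ , toWitness (Equivalence.from T-≡ found)
  where
  attains-max : ℕ → Bool
  attains-max i = ⌊ val k s i ≟ valMax k s ⌋
  attains-max-≡true : ∀ i → val k s i ≡ valMax k s → attains-max i ≡ true
  attains-max-≡true i eq = trans (isYes≗does _) (dec-true (val k s i ≟ valMax k s) eq)

val-+n : ∀ k {n} (s : Vec ℕ (suc n)) m → val k s (m + suc n) ≡ val k s m
val-+n k {n} s m = begin
  val k s (m + N)                                               ≡⟨ cong sum (map-upTo _ N) ⟩
  sum (applyUpTo (λ j → digit s (m + N + N ∸ suc j) * k ^ j) N) ≡⟨ sum-applyUpTo-cong _ _ N shift ⟩
  sum (applyUpTo (λ j → digit s (m + N ∸ suc j) * k ^ j) N)     ≡⟨ cong sum (map-upTo _ N) ⟨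
  val k s m                                                     ∎
  where
  open ≡-Reasoning
  N = suc n
  shift : ∀ {j} → j < N → digit s (m + N + N ∸ suc j) * k ^ j ≡ digit s (m + N ∸ suc j) * k ^ j
  shift {j} j<N = cong (_* k ^ j) (trans (cong (digit s) (+-∸-comm N (≤-trans j<N (m≤n+m N m))))
                                         (digit-+n s (m + N ∸ suc j)))

val≤valMax : ∀ k {n} (s : Vec ℕ (suc n)) {m} → m ≤ suc n → val k s m ≤ valMax k s
val≤valMax k {n} s m≤N with m≤n⇒m<n∨m≡n m≤N
... | inj₁ m<N  = ≤-foldr-⊔ (val k s) (∈-upTo⁺ m<N)
... | inj₂ refl = subst (_≤ valMax k s) (sym (val-+n k s 0))
                        (≤-foldr-⊔ (val k s) (∈-upTo⁺ {suc n} z<s))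

n≤m+o⇒-o≤m-n : ∀ {m n o} → n ≤ m + o → - (+ o) ≤ℤ (+ m) -ℤ (+ n)
n≤m+o⇒-o≤m-n {m} {n} {o} n≤m+o = begin
  - (+ o)              ≡⟨ cong (-_ ∘ +_) (m+n∸m≡n m o) ⟨
  - (+ (m + o ∸ m))    ≡⟨ ℤ.⊖-≤ (m≤m+n m o) ⟨
  m ⊖ (m + o)          ≤⟨ ℤ.⊖-monoʳ-≥-≤ m n≤m+o ⟩
  m ⊖ n                ≡⟨ ℤ.m-n≡m⊖n m n ⟨
  (+ m) -ℤ (+ n)       ∎
  where open ℤ.≤-Reasoning

claim25 : (n' k : ℕ) → 2 ≤ k →
          (x : Vec ℕ n') → All (_< k) x → x ≢ replicate n' 0 →
          (σ : ℕ) → σ < k →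
          tail k (x ∷ʳ σ) ≡ n' →
          (+ valMax k (0 ∷ x)) -ℤ (+ valMax k (x ∷ʳ σ))
            ≥ℤ - (+ ((k ∸ 1) * k ^ head k (x ∷ʳ σ)))
claim25 n' k _ x _ _ σ σ<k _ = n≤m+o⇒-o≤m-n valMax-bound
  where
  open ≤-Reasoning
  h = head k (x ∷ʳ σ)
  valMax-bound : valMax k (x ∷ʳ σ) ≤ valMax k (0 ∷ x) + (k ∸ 1) * k ^ h
  valMax-bound with head-spec k (x ∷ʳ σ)
  ... | h<1+n' , val-h≡valMax = begin
    valMax k (x ∷ʳ σ)                  ≡⟨ val-h≡valMax ⟨
    val k (x ∷ʳ σ) h                   ≡⟨ val-∷ʳ-rotate k x σ h<1+n' ⟩
    val k (0 ∷ x) (suc h) + σ * k ^ h  ≤⟨ +-mono-≤ (val≤valMax k (0 ∷ x) h<1+n')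
                                                   (*-monoˡ-≤ (k ^ h) (<⇒≤pred σ<k)) ⟩
    valMax k (0 ∷ x) + (k ∸ 1) * k ^ h ∎
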